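{- Let $(M,*)$ be a magma. The following are equivalent: (a) $(a*b)*(c*d)=(a*c)*(b*d)$ for all $a,b,c,d\in M$; (b) there exists an integer $n\ge 2$ such that $GSF(n,M)$ is abstractable; (c) $GSF(n,M)$ is abstractable for every $n\in\mathbb{N}$.
   Context: A magma $(M,*)$ is a set $M$ with a binary operation $*:M\times M\to M$ (no axioms). For $n\in\mathbb{N}$, $GSF(n,M)$ is the set of all functions $\{0,1\}^n\to M$. For $i\in\{1,\dots,n\}$ the abstraction $A(i):GSF(n,M)\to GSF(n,M)$ is defined by $A(i)(f)(b_1,\dots,b_n)=f(b_1,\dots,b_{i-1},0,b_{i+1},\dots,b_n)*f(b_1,\dots,b_{i-1},1,b_{i+1},\dots,b_n)$. $GSF(n,M)$ is called abstractable if $A(i)\circ A(j)(f)=A(j)\circ A(i)(f)$ for all $f\in GSF(n,M)$ and all $i,j\in\{1,\dots,n\}$. -}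

module Defs where

open import Data.Bool using (Bool; true; false)
open import Data.Nat using (ℕ)
open import Data.Fin using (Fin)
open import Data.Vec using (Vec; _[_]≔_)
open import Relation.Binary.PropositionalEquality using (_≡_)

-- GSF(n,M): functions {0,1}^n → M  (false = 0, true = 1)
GSF : ℕ → Set → Set
GSF n M = Vec Bool n → M

-- abstraction A(i); coordinate i ∈ {1..n} is represented by Fin n (0-based)
A : {M : Set} → (M → M → M) → {n : ℕ} → Fin n → GSF n M → GSF n M
A _*_ i f b = f (b [ i ]≔ false) * f (b [ i ]≔ true)

-- GSF(n,M) abstractable: A(i)∘A(j) f = A(j)∘A(i) f (equality of functions,
-- i.e. pointwise) for all f, i, j
Abstractable : {M : Set} → (M → M → M) → ℕ → Set
Abstractable {M} _*_ n =
  (f : GSF n M) (i j : Fin n) (b : Vec Bool n) →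
  A _*_ i (A _*_ j f) b ≡ A _*_ j (A _*_ i f) b

Medial : {M : Set} → (M → M → M) → Set
Medial {M} _*_ = (a b c d : M) → (a * b) * (c * d) ≡ (a * c) * (b * d)

-- Abstraction along i then j evaluates f at the four points of the face spanned by
-- coordinates i and j, combining them as (f₀₀ * f₀₁) * (f₁₀ * f₁₁); swapping i and j
-- gives (f₀₀ * f₁₀) * (f₀₁ * f₁₁). So the two orders agree for every f exactly when
-- the medial law holds, and two coordinates suffice to realise any four elements.
module Submission where

open import Defs
open import Data.Nat using (ℕ; suc; _≥_; s≤s; z≤n)
open import Data.Product using (_×_; Σ; _,_)
open import Data.Bool using (Bool; true; false)
open import Data.Fin using (Fin) renaming (zero to fzero; suc to fsuc)
open import Data.Fin.Properties using (_≟_)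
open import Data.Vec using (Vec; _∷_; _[_]≔_; replicate)
open import Data.Vec.Properties using ([]≔-commutes)
open import Relation.Nullary using (yes; no)
open import Relation.Binary.PropositionalEquality using (_≡_; refl; cong; cong₂; module ≡-Reasoning)

medial⇒abstractable : {M : Set} (_*_ : M → M → M) → Medial _*_ →
                      (n : ℕ) → Abstractable _*_ n
medial⇒abstractable _*_ medial n f i j b with i ≟ j
... | yes refl = refl
... | no i≢j = begin
    (f (b [ i ]≔ false [ j ]≔ false) * f (b [ i ]≔ false [ j ]≔ true))
      * (f (b [ i ]≔ true [ j ]≔ false) * f (b [ i ]≔ true [ j ]≔ true))
  ≡⟨ medial _ _ _ _ ⟩
    (f (b [ i ]≔ false [ j ]≔ false) * f (b [ i ]≔ true [ j ]≔ false))
      * (f (b [ i ]≔ false [ j ]≔ true) * f (b [ i ]≔ true [ j ]≔ true))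
  ≡⟨ cong₂ _*_ (cong₂ _*_ (swap false false) (swap true false))
               (cong₂ _*_ (swap false true) (swap true true)) ⟩
    (f (b [ j ]≔ false [ i ]≔ false) * f (b [ j ]≔ false [ i ]≔ true))
      * (f (b [ j ]≔ true [ i ]≔ false) * f (b [ j ]≔ true [ i ]≔ true))
  ∎
  where
  open ≡-Reasoning
  swap : ∀ x y → f (b [ i ]≔ x [ j ]≔ y) ≡ f (b [ j ]≔ y [ i ]≔ x)
  swap x y = cong f ([]≔-commutes b i j i≢j)

abstractable⇒medial : {M : Set} (_*_ : M → M → M) (n : ℕ) → n ≥ 2 →
                      Abstractable _*_ n → Medial _*_
abstractable⇒medial {M} _*_ n@(suc (suc _)) (s≤s (s≤s _)) abstractable a b c d =
  abstractable f fzero (fsuc fzero) (replicate n false)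
  where
  f : GSF n M
  f (false ∷ false ∷ _) = a
  f (false ∷ true  ∷ _) = b
  f (true  ∷ false ∷ _) = c
  f (true  ∷ true  ∷ _) = d

corollary1 : (M : Set) (_*_ : M → M → M) →
    ((Medial _*_ → Σ ℕ (λ n → n ≥ 2 × Abstractable _*_ n))
    × ((Σ ℕ (λ n → n ≥ 2 × Abstractable _*_ n)) → ((n : ℕ) → Abstractable _*_ n)))
    × (((n : ℕ) → Abstractable _*_ n) → Medial _*_)
corollary1 M _*_ =
  ( (λ medial → 2 , s≤s (s≤s z≤n) , medial⇒abstractable _*_ medial 2)
  , (λ { (n , n≥2 , abstractable) →
           medial⇒abstractable _*_ (abstractable⇒medial _*_ n n≥2 abstractable) }) )
  , (λ abstractableAll → abstractable⇒medial _*_ 2 (s≤s (s≤s z≤n)) (abstractableAll 2))
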